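{- For every integer $M\ge1$, $A(M^2)=B(M^2)$, where $A(x)$ denotes the number of almost-squares not exceeding $x$ and $B$ is the function defined below.
   Context: For a positive integer $n$, let $s(n)=\min_{d\mid n}(d+n/d)$ and $F(n)=n/s(n)$. A positive integer $n$ is an almost-square if $F(k)\le F(n)$ for all positive integers $k\le n$. Let $\{x\}=x-\lfloor x\rfloor$ be the fractional part, and for $x>0$ let $\gamma=\gamma(x)=\{\sqrt2\,x^{1/4}\}$ and $\delta=\delta(x)=\{x^{1/4}/\sqrt2\}$. Define $B(x)=B_0(x)+B_1(x)$ with $$B_0(x)=\frac{2\sqrt2}{3}x^{3/4}+\frac12x^{1/2}+\Big(\frac{2\sqrt2}{3}+\frac{\gamma(1-\gamma)}{\sqrt2}\Big)x^{1/4},\qquad B_1(x)=\frac{\gamma^3}{6}-\frac{\gamma^2}{4}-\frac{5\gamma}{12}-\frac{\delta}{2}-1.$$ -}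

module Defs where

open import Data.Nat as ℕ using (ℕ; zero; suc; _⊓_; _≤_; _<_)
open import Data.Nat.Divisibility using (_∣?_)
open import Data.Nat.DivMod using (_/_)
open import Data.Integer using (ℤ; +_)
open import Data.Rational as ℚ using (ℚ; 0ℚ; 1ℚ)
open import Data.List using (List; map; foldr; filter; upTo; length)
open import Data.List.Relation.Unary.All using (All; all?)
open import Relation.Nullary using (Dec)
open import Relation.Binary.PropositionalEquality using (_≡_)
open import Data.Product using (_×_)

-- s(n) = min_{d ∣ n} (d + n/d).  Divisors d range over 1..n (d = suc i,
-- i < n).  The seed value 1 + n is the value at d = 1, so it does not
-- change the minimum (for n ≥ 1).

s : ℕ → ℕ
s n = foldr _⊓_ (suc n)
        (map (λ i → suc i ℕ.+ n / suc i)
             (filter (λ i → suc i ∣? n) (upTo n)))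

-- F(k) ≤ F(n), i.e. k / s(k) ≤ n / s(n), cross-multiplied (s > 0).
FLe : ℕ → ℕ → Set
FLe k n = k ℕ.* s n ≤ n ℕ.* s k

AlmostSquare : ℕ → Set
AlmostSquare n = All (λ k → FLe k n) (map suc (upTo n))

almostSquare? : (n : ℕ) → Dec (AlmostSquare n)
almostSquare? n = all? (λ k → k ℕ.* s n ℕ.≤? n ℕ.* s k) (map suc (upTo n))

A : ℕ → ℕ
A x = length (filter almostSquare? (map suc (upTo x)))

-- Exact arithmetic in ℚ(a) with a = √D (D ≥ 0 a rational):
-- the pair (r , t) stands for the real number r + t·a.

record Qa : Set where
  constructor _⊕_·a
  field
    re im : ℚ
open Qa public

emb : ℚ → Qa
emb r = r ⊕ 0ℚ ·a

module QaOps (D : ℚ) where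
  infixl 6 _+'_ _-'_
  infixl 7 _*'_
  _+'_ : Qa → Qa → Qa
  (r ⊕ t ·a) +' (r' ⊕ t' ·a) = (r ℚ.+ r') ⊕ (t ℚ.+ t') ·a
  _-'_ : Qa → Qa → Qa
  (r ⊕ t ·a) -' (r' ⊕ t' ·a) = (r ℚ.- r') ⊕ (t ℚ.- t') ·a
  _*'_ : Qa → Qa → Qa
  (r ⊕ t ·a) *' (r' ⊕ t' ·a) =
    (r ℚ.* r' ℚ.+ (t ℚ.* t') ℚ.* D) ⊕ (r ℚ.* t' ℚ.+ t ℚ.* r') ·a

  -- the real number r + t·√D equals the rational q  (D ≥ 0):
  --   t·√D = q − r  ⇔  (q − r)² = t²·D  and  t·(q − r) ≥ 0.
  RealEq : Qa → ℚ → Set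
  RealEq x q = ((q ℚ.- re x) ℚ.* (q ℚ.- re x) ≡ (im x ℚ.* im x) ℚ.* D)
             × (0ℚ ℚ.≤ im x ℚ.* (q ℚ.- re x))

ℕ→ℚ : ℕ → ℚ
ℕ→ℚ n = + n ℚ./ 1

-- B(M²), written in ℚ(a) with a = √(2M) = √2·(M²)^{1/4}.
-- Given p = ⌊a⌋ and q = ⌊a/2⌋:
--   γ = {√2 x^{1/4}} = a − p,   δ = {x^{1/4}/√2} = a/2 − q,
--   (2√2/3) x^{3/4} = (2/3)·M·a,   x^{1/2} = M,
--   (2√2/3 + γ(1−γ)/√2) x^{1/4} = (2/3 + γ(1−γ)/2)·a .

BAt : (M p q : ℕ) → Qa
BAt M p q = B0 +' B1
  where
  open QaOps (ℕ→ℚ (2 ℕ.* M))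
  a  = 0ℚ ⊕ 1ℚ ·a
  c  : ℚ → Qa
  c  = emb
  m  = c (ℕ→ℚ M)
  γ  = a -' c (ℕ→ℚ p)
  δ  = a *' c (+ 1 ℚ./ 2) -' c (ℕ→ℚ q)
  B0 = c (+ 2 ℚ./ 3) *' m *' a
       +' c (+ 1 ℚ./ 2) *' m
       +' (c (+ 2 ℚ./ 3) +' γ *' (c 1ℚ -' γ) *' c (+ 1 ℚ./ 2)) *' a
  B1 = γ *' γ *' γ *' c (+ 1 ℚ./ 6)
       -' γ *' γ *' c (+ 1 ℚ./ 4)
       -' γ *' c (+ 5 ℚ./ 12)
       -' δ *' c (+ 1 ℚ./ 2)
       -' c 1ℚ

AEqB : (M p q : ℕ) → Set
AEqB M p q = QaOps.RealEq (ℕ→ℚ (2 ℕ.* M)) (BAt M p q) (ℕ→ℚ (A (M ℕ.* M)))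

module Submission where

-- Write s n = d + e for an optimal factor pair n = d e, d ≤ e.  For n ≥ 1, n is an
-- almost-square iff s(n)² ≤ 4n + s(n), i.e. (e − d)² ≤ d + e: this bound gives
-- F(k) ≤ F(n) for k ≤ n via 4k ≤ s(k)², and if it fails then k = v² or k = v (v + 1),
-- v = ⌊√n⌋, has larger F.  Between M² and (M + 1)² the n satisfying it are therefore
-- n = d (d + h) with 2d + h ∈ {2M + 1, 2M + 2} and h² ≤ 2M + 2, one for each such h, so
-- A((M + 1)²) = A(M²) + ⌊√(2M + 2)⌋ + 1.  Summing, A(M²) is a cubic in p = ⌊√(2M)⌋ and
-- q = ⌊p/2⌋; expanding B(M²) in ℚ(√(2M)), its irrational part cancels and its rational
-- part is the same cubic.

open import Defs
open import Data.Nat as ℕ using (ℕ; NonZero; zero; suc; _+_; _*_; _≤_; _<_; _⊓_; z≤n; s≤s; _≤?_; _<?_)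
open import Data.Nat.Properties
open import Data.Nat.Divisibility using (_∣?_; divides)
open import Data.Nat.DivMod using (_/_; m*n/n≡m; m/n*n≡m)
open import Data.Nat.Tactic.RingSolver using (solve)
open import Data.Nat.Coprimality using (1-coprimeTo) renaming (sym to coprime-sym)
open import Data.Integer as ℤ using (+_)
import Data.Integer.Properties as ℤ
open import Data.Rational as ℚ using (ℚ; 0ℚ; 1ℚ)
import Data.Rational.Properties as ℚ
open import Data.Rational.Solver using (module +-*-Solver)
open +-*-Solver using (Polynomial; con; var; _:+_; _:*_; _:-_; ⟦_⟧; prove)
open import Data.Fin using (Fin; #_)
open import Data.List using ([]; _∷_; [_]; map; foldr; filter; upTo; length; _++_)
open import Data.List.Properties using (upTo-∷ʳ; map-++; filter-++; length-++; foldr-preservesᵒ)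
open import Data.List.Membership.Propositional using (_∈_)
open import Data.List.Membership.Propositional.Properties
  using (∈-map⁺; ∈-map⁻; ∈-filter⁺; ∈-filter⁻; ∈-upTo⁺; ∈-upTo⁻; foldr-selective)
import Data.List.Relation.Unary.Any as Any
import Data.List.Relation.Unary.All as All
open import Data.Vec as Vec using (Vec; lookup)
open import Data.Vec.Properties using (lookup-map)
open import Data.Product using (∃; ∃₂; _×_; _,_; proj₁; proj₂)
open import Data.Sum as Sum using (_⊎_; inj₁; inj₂)
open import Data.Empty using (⊥; ⊥-elim)
open import Relation.Nullary using (Dec; yes; no; ¬_)
open import Relation.Nullary.Decidable using (decidable-stable; _×-dec_; _⊎-dec_)
open import Relation.Binary.PropositionalEquality hiding ([_])
open import Function using (_∋_)
open import Algebra.Properties.CommutativeSemigroup +-commutativeSemigroup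
  using () renaming (interchange to +-interchange)

m+o≡n⇒m≤n : ∀ {m n} o → m + o ≡ n → m ≤ n
m+o≡n⇒m≤n {m} o refl = m≤m+n m o

m≤n<2+m⇒n≡m⊎n≡1+m : ∀ {m n} → m ≤ n → n < 2 + m → n ≡ m ⊎ n ≡ suc m
m≤n<2+m⇒n≡m⊎n≡1+m {m} {n} m≤n n<2+m with n ℕ.≟ suc m
... | yes n≡1+m = inj₂ n≡1+m
... | no  n≢1+m = inj₁ (≤-antisym (≤-pred (≤∧≢⇒< (≤-pred n<2+m) n≢1+m)) m≤n)

n≤n*n : ∀ n → n ≤ n * n
n≤n*n zero    = z≤n
n≤n*n (suc n) = m≤m*n (suc n) (suc n)

m*m≤n*n⇒m≤n : ∀ {m n} → m * m ≤ n * n → m ≤ n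
m*m≤n*n⇒m≤n {m} {n} le with m ≤? n
... | yes m≤n = m≤n
... | no  m≰n = let n<m = ≰⇒> m≰n in ⊥-elim (<⇒≱ (*-mono-< n<m n<m) le)

m*m<n*n⇒m<n : ∀ {m n} → m * m < n * n → m < n
m*m<n*n⇒m<n {m} {n} lt with m <? n
... | yes m<n = m<n
... | no  m≮n = let n≤m = ≮⇒≥ m≮n in ⊥-elim (<⇒≱ lt (*-mono-≤ n≤m n≤m))

m*m≡n*n⇒m≡n : ∀ {m n} → m * m ≡ n * n → m ≡ n
m*m≡n*n⇒m≡n eq = ≤-antisym (m*m≤n*n⇒m≤n (≤-reflexive eq)) (m*m≤n*n⇒m≤n (≤-reflexive (sym eq)))

m≤n∧n*n≤o+n⇒m*m≤o+m : ∀ {m n o} → m ≤ n → n * n ≤ o + n → m * m ≤ o + m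
m≤n∧n*n≤o+n⇒m*m≤o+m {m} {n} {o} m≤n n*n≤o+n with r , refl ← m≤n⇒∃[o]m+o≡n m≤n =
  +-cancelʳ-≤ (m + r) (m * m) (o + m) (begin
    m * m + (m + r)                   ≡⟨ solve (m ∷ r ∷ []) ⟩
    (m * m + m) + r                   ≤⟨ +-monoʳ-≤ (m * m + m) (≤-trans (n≤n*n r) (m≤n+m (r * r) (2 * m * r))) ⟩
    (m * m + m) + (2 * m * r + r * r) ≡⟨ solve (m ∷ r ∷ []) ⟩
    (m + r) * (m + r) + m             ≤⟨ +-monoˡ-≤ m n*n≤o+n ⟩
    o + (m + r) + m                   ≡⟨ solve (o ∷ m ∷ r ∷ []) ⟩
    (o + m) + (m + r)                 ∎)
  where open ≤-Reasoning

m*m≤o+m∧o+n<n*n⇒m<n : ∀ {m n o} → m * m ≤ o + m → o + n < n * n → m < n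
m*m≤o+m∧o+n<n*n⇒m<n {m} {n} m*m≤o+m o+n<n*n with m <? n
... | yes m<n = m<n
... | no  m≮n = ⊥-elim (<⇒≱ o+n<n*n (m≤n∧n*n≤o+n⇒m*m≤o+m (≮⇒≥ m≮n) m*m≤o+m))

Half : ℕ → ℕ → Set
Half p q = p ≡ 2 * q ⊎ p ≡ suc (2 * q)

half : ∀ p → ∃ (Half p)
half zero = 0 , inj₁ refl
half (suc p) with half p
... | q , inj₁ refl = q , inj₂ refl
... | q , inj₂ refl = suc q , inj₁ (sym (*-suc 2 q))

half-unique : ∀ {p q q′} → Half p q → Half p q′ → q ≡ q′
half-unique (inj₁ refl) (inj₁ eq) = *-cancelˡ-≡ _ _ 2 eq
half-unique {q = q} {q′} (inj₁ refl) (inj₂ eq) = ⊥-elim (even≢odd q q′ eq)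
half-unique {q = q} {q′} (inj₂ refl) (inj₁ eq) = ⊥-elim (even≢odd q′ q (sym eq))
half-unique (inj₂ refl) (inj₂ eq) = *-cancelˡ-≡ _ _ 2 (suc-injective eq)

FloorSqrt : ℕ → ℕ → Set
FloorSqrt n r = r * r ≤ n × n < suc r * suc r

floorSqrt : ∀ n → ∃ (FloorSqrt n)
floorSqrt zero = 0 , z≤n , s≤s z≤n
floorSqrt (suc n) with floorSqrt n
... | r , lo , hi with suc n <? suc r * suc r
...   | yes n<[r+1]² = r , m≤n⇒m≤1+n lo , n<[r+1]²
...   | no  n≮[r+1]² = suc r , ≮⇒≥ n≮[r+1]² , ≤-<-trans hi (*-mono-< (n<1+n (suc r)) (n<1+n (suc r)))

floorSqrt-unique : ∀ {n r r′} → FloorSqrt n r → FloorSqrt n r′ → r ≡ r′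
floorSqrt-unique (lo , hi) (lo′ , hi′) =
  ≤-antisym (≤-pred (m*m<n*n⇒m<n (≤-<-trans lo hi′))) (≤-pred (m*m<n*n⇒m<n (≤-<-trans lo′ hi)))

-- Finite sums and counting

∑< : ℕ → (ℕ → ℕ) → ℕ
∑< zero    f = 0
∑< (suc n) f = ∑< n f + f n

syntax ∑< n (λ i → e) = ∑[ i < n ] e

∑-cong : ∀ n {f g} → (∀ i → i < n → f i ≡ g i) → ∑< n f ≡ ∑< n g
∑-cong zero    f≗g = refl
∑-cong (suc n) f≗g = cong₂ _+_ (∑-cong n λ i i<n → f≗g i (m<n⇒m<1+n i<n)) (f≗g n ≤-refl)

∑-zero : ∀ n {f} → (∀ i → i < n → f i ≡ 0) → ∑< n f ≡ 0
∑-zero zero    f≗0 = refl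
∑-zero (suc n) f≗0 = cong₂ _+_ (∑-zero n λ i i<n → f≗0 i (m<n⇒m<1+n i<n)) (f≗0 n ≤-refl)

∑-distrib-+ : ∀ n f g → ∑[ i < n ] (f i + g i) ≡ ∑< n f + ∑< n g
∑-distrib-+ zero    f g = refl
∑-distrib-+ (suc n) f g = begin
  ∑[ i < n ] (f i + g i) + (f n + g n) ≡⟨ cong (_+ (f n + g n)) (∑-distrib-+ n f g) ⟩
  ∑< n f + ∑< n g + (f n + g n)        ≡⟨ +-interchange (∑< n f) (∑< n g) (f n) (g n) ⟩
  ∑< n f + f n + (∑< n g + g n)        ∎
  where open ≡-Reasoning

∑-swap : ∀ m n (f : ℕ → ℕ → ℕ) → ∑[ i < m ] ∑[ j < n ] f i j ≡ ∑[ j < n ] ∑[ i < m ] f i j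
∑-swap zero    n f = sym (∑-zero n λ _ _ → refl)
∑-swap (suc m) n f = trans (cong (_+ ∑[ j < n ] f m j) (∑-swap m n f))
                           (sym (∑-distrib-+ n (λ j → ∑[ i < m ] f i j) (f m)))

∑-split : ∀ m n f → ∑< (m + n) f ≡ ∑< m f + ∑[ i < n ] f (m + i)
∑-split m zero    f = trans (cong (λ k → ∑< k f) (+-identityʳ m)) (sym (+-identityʳ (∑< m f)))
∑-split m (suc n) f rewrite +-suc m n | ∑-split m n f = +-assoc (∑< m f) _ _

∑-const-1 : ∀ n → ∑[ i < n ] 1 ≡ n
∑-const-1 zero    = refl
∑-const-1 (suc n) = trans (cong (_+ 1) (∑-const-1 n)) (+-comm n 1)

𝟙 : ∀ {P : Set} → Dec P → ℕ
𝟙 (yes _) = 1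
𝟙 (no _)  = 0

𝟙-yes : ∀ {P : Set} (P? : Dec P) → P → 𝟙 P? ≡ 1
𝟙-yes (yes _) _ = refl
𝟙-yes (no ¬p) p = ⊥-elim (¬p p)

𝟙-no : ∀ {P : Set} (P? : Dec P) → ¬ P → 𝟙 P? ≡ 0
𝟙-no (yes p) ¬p = ⊥-elim (¬p p)
𝟙-no (no _)  _  = refl

𝟙-cong : ∀ {P Q : Set} → (P → Q) → (Q → P) → (P? : Dec P) (Q? : Dec Q) → 𝟙 P? ≡ 𝟙 Q?
𝟙-cong P⇒Q Q⇒P (yes p) Q? = sym (𝟙-yes Q? (P⇒Q p))
𝟙-cong P⇒Q Q⇒P (no ¬p) Q? = sym (𝟙-no Q? (λ q → ¬p (Q⇒P q)))

module _ {R : ℕ → Set} (R? : ∀ i → Dec (R i)) where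

  ∑𝟙-single : ∀ n {i₀} → i₀ < n → R i₀ → (∀ {i} → R i → i ≡ i₀) → ∑[ i < n ] 𝟙 (R? i) ≡ 1
  ∑𝟙-single (suc n) {i₀} i₀<1+n Ri₀ only-i₀ with i₀ ℕ.≟ n
  ... | yes refl = cong₂ _+_ (∑-zero n λ i i<n → 𝟙-no (R? i) λ Ri → <-irrefl (only-i₀ Ri) i<n)
                             (𝟙-yes (R? n) Ri₀)
  ... | no  i₀≢n = cong₂ _+_ (∑𝟙-single n (≤∧≢⇒< (≤-pred i₀<1+n) i₀≢n) Ri₀ only-i₀)
                             (𝟙-no (R? n) λ Rn → i₀≢n (sym (only-i₀ Rn)))

  ∑𝟙-unique : ∀ n {P : Set} (P? : Dec P) → (∀ {i} → R i → P) → (P → ∃ λ i → i < n × R i) →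
              (∀ {i j} → R i → R j → i ≡ j) → ∑[ i < n ] 𝟙 (R? i) ≡ 𝟙 P?
  ∑𝟙-unique n (no ¬p) R⇒P P⇒R unique = ∑-zero n λ i _ → 𝟙-no (R? i) λ Ri → ¬p (R⇒P Ri)
  ∑𝟙-unique n (yes p) R⇒P P⇒R unique with i₀ , i₀<n , Ri₀ ← P⇒R p =
    ∑𝟙-single n i₀<n Ri₀ λ Ri → unique Ri Ri₀

  ∑𝟙-initial : ∀ {c n} → c ≤ n → (∀ i → i < c → R i) → (∀ i → c ≤ i → ¬ R i) →
               ∑[ i < n ] 𝟙 (R? i) ≡ c
  ∑𝟙-initial {c} c≤n below above with k , refl ← m≤n⇒∃[o]m+o≡n c≤n = begin
    ∑[ i < c + k ] 𝟙 (R? i)                        ≡⟨ ∑-split c k _ ⟩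
    ∑[ i < c ] 𝟙 (R? i) + ∑[ i < k ] 𝟙 (R? (c + i)) ≡⟨ cong₂ _+_ ones zeros ⟩
    c + 0                                          ≡⟨ +-identityʳ c ⟩
    c                                              ∎
    where
    open ≡-Reasoning
    ones : ∑[ i < c ] 𝟙 (R? i) ≡ c
    ones = trans (∑-cong c λ i i<c → 𝟙-yes (R? i) (below i i<c)) (∑-const-1 c)
    zeros : ∑[ i < k ] 𝟙 (R? (c + i)) ≡ 0
    zeros = ∑-zero k λ i _ → 𝟙-no (R? (c + i)) (above (c + i) (m≤m+n c i))

length-filter-[_] : ∀ {P : ℕ → Set} (P? : ∀ x → Dec (P x)) x → length (filter P? [ x ]) ≡ 𝟙 (P? x)
length-filter-[ P? ] x with P? x
... | yes _ = refl
... | no  _ = refl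

A-suc : ∀ x → A (suc x) ≡ A x + 𝟙 (almostSquare? (suc x))
A-suc x = begin
  length (filter almostSquare? (map suc (upTo (suc x))))
    ≡⟨ cong (λ l → length (filter almostSquare? (map suc l))) (sym (upTo-∷ʳ x)) ⟩
  length (filter almostSquare? (map suc (upTo x ++ [ x ])))
    ≡⟨ cong (λ l → length (filter almostSquare? l)) (map-++ suc (upTo x) [ x ]) ⟩
  length (filter almostSquare? (map suc (upTo x) ++ [ suc x ]))
    ≡⟨ cong length (filter-++ almostSquare? (map suc (upTo x)) [ suc x ]) ⟩
  length (filter almostSquare? (map suc (upTo x)) ++ filter almostSquare? [ suc x ])
    ≡⟨ length-++ (filter almostSquare? (map suc (upTo x))) ⟩
  A x + length (filter almostSquare? [ suc x ])
    ≡⟨ cong (A x ℕ.+_) (length-filter-[ almostSquare? ] (suc x)) ⟩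
  A x + 𝟙 (almostSquare? (suc x)) ∎
  where open ≡-Reasoning

A≡∑ : ∀ x → A x ≡ ∑[ i < x ] 𝟙 (almostSquare? (suc i))
A≡∑ zero    = refl
A≡∑ (suc x) = trans (A-suc x) (cong (_+ 𝟙 (almostSquare? (suc x))) (A≡∑ x))

-- The function s and almost-squares

foldr-⊓-≤ : ∀ z {x} xs → x ∈ xs → foldr _⊓_ z xs ≤ x
foldr-⊓-≤ z {x} xs x∈xs = foldr-preservesᵒ {P = _≤ x}
  (λ { a b (inj₁ a≤x) → ≤-trans (m⊓n≤m a b) a≤x ; a b (inj₂ b≤x) → ≤-trans (m⊓n≤n a b) b≤x }) z xs
  (inj₂ (Any.map (λ x≡y → ≤-reflexive (sym x≡y)) x∈xs))

s≤ : ∀ d e → s (suc d * e) ≤ suc d + e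
s≤ d zero    rewrite *-zeroʳ d = s≤s z≤n
s≤ d (suc e) = subst (λ e′ → s n ≤ suc d + e′) n/d≡e (foldr-⊓-≤ (suc n) _ d+n/d∈)
  where
  n : ℕ
  n = suc d * suc e
  d+n/d∈ : suc d + n / suc d ∈ map (λ i → suc i + n / suc i) (filter (λ i → suc i ∣? n) (upTo n))
  d+n/d∈ = ∈-map⁺ _ (∈-filter⁺ (λ i → suc i ∣? n) (∈-upTo⁺ (m≤m*n (suc d) (suc e)))
                              (divides (suc e) (*-comm (suc d) (suc e))))
  n/d≡e : n / suc d ≡ suc e
  n/d≡e = trans (cong (_/ suc d) (*-comm (suc d) (suc e))) (m*n/n≡m (suc e) (suc d))

factor-pair-identity : ∀ d h → 4 * (d * (d + h)) + h * h ≡ (d + (d + h)) * (d + (d + h))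
factor-pair-identity d h = solve (d ∷ h ∷ [])

factor-pair-ordered : ∀ d e → ∃₂ λ c h → d * e ≡ c * (c + h) × d + e ≡ c + (c + h)
factor-pair-ordered d e with ≤-total d e
... | inj₁ d≤e with h , refl ← m≤n⇒∃[o]m+o≡n d≤e = d , h , refl , refl
... | inj₂ e≤d with h , refl ← m≤n⇒∃[o]m+o≡n e≤d = e , h , *-comm (e + h) e , +-comm (e + h) e

s-attained : ∀ n → ∃₂ λ d h → n ≡ d * (d + h) × s n ≡ d + (d + h)
s-attained n with foldr-selective ⊓-sel (suc n) (map (λ i → suc i + n / suc i) (filter (λ i → suc i ∣? n) (upTo n)))
... | inj₁ sn≡1+n = let d , h , n≡ , 1+n≡ = factor-pair-ordered 1 n in
  d , h , trans (sym (*-identityˡ n)) n≡ , trans sn≡1+n 1+n≡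
... | inj₂ sn∈ with i , i∈ , sn≡ ← ∈-map⁻ _ sn∈ =
  let d , h , n≡ , sn≡′ = factor-pair-ordered (suc i) (n / suc i)
      i+1∣n = proj₂ (∈-filter⁻ (λ i → suc i ∣? n) {xs = upTo n} i∈)
  in d , h , trans (sym (trans (*-comm (suc i) _) (m/n*n≡m i+1∣n))) n≡ , trans sn≡ sn≡′

4n≤s*s : ∀ n → 4 * n ≤ s n * s n
4n≤s*s n with d , h , refl , sn≡ ← s-attained n =
  subst (λ t → 4 * (d * (d + h)) ≤ t * t) (sym sn≡) (m+o≡n⇒m≤n (h * h) (factor-pair-identity d h))

-- For an optimal factor pair n = d e this says (e − d)² ≤ d + e.
Balanced : ℕ → Set
Balanced n = s n * s n ≤ 4 * n + s n

balanced? : ∀ n → Dec (Balanced n)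
balanced? n = s n * s n ≤? 4 * n + s n

factor-pair⇒balanced : ∀ d e → (d + e) * (d + e) ≤ 4 * (d * e) + (d + e) → Balanced (d * e)
factor-pair⇒balanced zero    e _  = s≤s z≤n
factor-pair⇒balanced (suc d) e le = m≤n∧n*n≤o+n⇒m*m≤o+m (s≤ d e) le

balanced⇒FLe : ∀ {k n} → k ≤ n → Balanced n → FLe k n
balanced⇒FLe {k} {n} k≤n bal with s n ≤? s k
... | yes sn≤sk = *-mono-≤ k≤n sn≤sk
... | no  sn≰sk = *-cancelˡ-≤ 4 (begin
    4 * (k * t) ≡⟨ *-assoc 4 k t ⟨
    4 * k * t   ≤⟨ *-monoˡ-≤ t (4n≤s*s k) ⟩
    u * u * t   ≡⟨ *-assoc u u t ⟩
    u * (u * t) ≤⟨ *-monoʳ-≤ u u*t≤4n ⟩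
    u * (4 * n) ≡⟨ *-comm u (4 * n) ⟩
    4 * n * u   ≡⟨ *-assoc 4 n u ⟩
    4 * (n * u) ∎)
  where
  open ≤-Reasoning
  t u : ℕ
  t = s n
  u = s k
  u*t≤4n : u * t ≤ 4 * n
  u*t≤4n = +-cancelˡ-≤ t _ _
    (≤-trans (*-monoˡ-≤ t (≰⇒> sn≰sk)) (≤-trans bal (≤-reflexive (+-comm (4 * n) t))))

balanced⇒almostSquare : ∀ {n} → Balanced n → AlmostSquare n
balanced⇒almostSquare {n} bal = All.tabulate λ k∈ →
  let i , i∈ , k≡1+i = ∈-map⁻ suc k∈ in subst (λ k → FLe k n) (sym k≡1+i) (balanced⇒FLe (∈-upTo⁻ i∈) bal)

-- With t = s n and v = ⌊√n⌋ the conclusion says F(v²) > F(n), as s(v²) ≤ 2v; likewise F(v (v + 1)) > F(n)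
-- in oblong-beats, as s(v (v + 1)) ≤ 2v + 1.
square-beats : ∀ v {n t} → .{{NonZero v}} → v * v ≤ n → n < v * v + v → 4 * n + t < t * t →
               n * (v + v) < v * v * t
square-beats v@(suc w) {n} {t} v²≤n n<v²+v unbal = begin-strict
  n * (v + v)  ≡⟨ solve (n ∷ w ∷ []) ⟩
  v * (2 * n)  <⟨ *-monoʳ-< v (2n<vt (m≤n⇒∃[o]m+o≡n 2v<t) unbal) ⟩
  v * (v * t)  ≡⟨ *-assoc v v t ⟨
  v * v * t    ∎
  where
  open ≤-Reasoning
  2v<t : v + v < t
  2v<t = m*m≤o+m∧o+n<n*n⇒m<n (begin
    (v + v) * (v + v) ≡⟨ solve (w ∷ []) ⟩
    4 * (v * v)       ≤⟨ *-monoʳ-≤ 4 v²≤n ⟩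
    4 * n             ≤⟨ m≤m+n (4 * n) (v + v) ⟩
    4 * n + (v + v)   ∎) unbal
  2n<vt : ∀ {t′} → ∃ (λ r → suc (v + v) + r ≡ t′) → 4 * n + t′ < t′ * t′ → 2 * n < v * t′
  2n<vt (zero , refl) unbal′ = *-cancelˡ-< 2 (2 * n) _ (+-cancelʳ-< (2 * v + 1) _ _ (begin-strict
    2 * (2 * n) + (2 * v + 1)    ≡⟨ solve (n ∷ w ∷ []) ⟩
    4 * n + (suc (v + v) + 0)    <⟨ unbal′ ⟩
    (suc (v + v) + 0) * (suc (v + v) + 0) ≡⟨ solve (w ∷ []) ⟩
    2 * (v * (suc (v + v) + 0)) + (2 * v + 1) ∎))
  2n<vt (suc r , refl) _ = begin-strict
    2 * n                <⟨ *-monoʳ-< 2 n<v²+v ⟩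
    2 * (v * v + v)      ≤⟨ m+o≡n⇒m≤n (v * r) (solve (w ∷ r ∷ [])) ⟩
    v * (suc (v + v) + suc r) ∎

oblong-beats : ∀ v {n t} → .{{NonZero v}} → v * v + v ≤ n → n < suc v * suc v → 4 * n + t < t * t →
               n * (v + suc v) < v * suc v * t
oblong-beats v@(suc w) {n} {t} v²+v≤n n<[v+1]² unbal = beats (m≤n⇒∃[o]m+o≡n 2v+1<t) unbal
  where
  open ≤-Reasoning
  2v+1<t : v + suc v < t
  2v+1<t = m*m≤o+m∧o+n<n*n⇒m<n (begin
    (v + suc v) * (v + suc v)     ≡⟨ solve (w ∷ []) ⟩
    4 * (v * v + v) + 1           ≤⟨ +-mono-≤ (*-monoʳ-≤ 4 v²+v≤n) (s≤s z≤n) ⟩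
    4 * n + (v + suc v)           ∎) unbal
  beats : ∀ {t′} → ∃ (λ r → suc (v + suc v) + r ≡ t′) → 4 * n + t′ < t′ * t′ →
          n * (v + suc v) < v * suc v * t′
  beats (zero , refl) unbal′ = *-cancelˡ-< 2 _ _ (begin-strict
    2 * (n * (v + suc v))               ≡⟨ *-assoc 2 n (v + suc v) ⟨
    2 * n * (v + suc v)                 ≤⟨ *-monoˡ-≤ (v + suc v) 2n≤ ⟩
    (2 * (v * v) + 3 * v) * (v + suc v) <⟨ m+o≡n⇒m≤n w (solve (w ∷ [])) ⟩
    2 * (v * suc v * (suc (v + suc v) + 0)) ∎)
    where
    2n≤ : 2 * n ≤ 2 * (v * v) + 3 * v
    2n≤ = ≤-pred (*-cancelˡ-< 2 (2 * n) _ (+-cancelʳ-< (2 * v + 2) _ _ (begin-strict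
      2 * (2 * n) + (2 * v + 2)                     ≡⟨ solve (n ∷ w ∷ []) ⟩
      4 * n + (suc (v + suc v) + 0)                 <⟨ unbal′ ⟩
      (suc (v + suc v) + 0) * (suc (v + suc v) + 0) ≡⟨ solve (w ∷ []) ⟩
      2 * suc (2 * (v * v) + 3 * v) + (2 * v + 2)   ∎)))
  beats (suc r , refl) _ = begin-strict
    n * (v + suc v)               ≤⟨ *-monoˡ-≤ (v + suc v) n≤ ⟩
    (v * v + 2 * v) * (v + suc v) <⟨ m+o≡n⇒m≤n (w + v * suc v * r) (solve (w ∷ r ∷ [])) ⟩
    v * suc v * (suc (v + suc v) + suc r) ∎
    where
    n≤ : n ≤ v * v + 2 * v
    n≤ = ≤-pred (begin-strict
      n                   <⟨ n<[v+1]² ⟩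
      suc v * suc v       ≡⟨ solve (w ∷ []) ⟩
      suc (v * v + 2 * v) ∎)

unbalanced-beaten : ∀ {n} → 1 ≤ n → ¬ Balanced n → ∃ λ k → 1 ≤ k × k ≤ n × ¬ FLe k n
unbalanced-beaten {n} 1≤n ¬bal with floorSqrt n
... | zero , _ , n<1 = ⊥-elim (<⇒≱ n<1 1≤n)
... | v@(suc w) , v²≤n , n<[v+1]² with n <? v * v + v
...   | yes n<v²+v = v * v , s≤s z≤n , v²≤n ,
        <⇒≱ (≤-<-trans (*-monoʳ-≤ n (s≤ w v)) (square-beats v v²≤n n<v²+v (≰⇒> ¬bal)))
...   | no  n≮v²+v = v * suc v , s≤s z≤n ,
        ≤-trans (≤-reflexive (trans (*-suc v v) (+-comm v (v * v)))) (≮⇒≥ n≮v²+v) ,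
        <⇒≱ (≤-<-trans (*-monoʳ-≤ n (s≤ w (suc v))) (oblong-beats v (≮⇒≥ n≮v²+v) n<[v+1]² (≰⇒> ¬bal)))

almostSquare⇒FLe : ∀ {n k} → AlmostSquare n → 1 ≤ k → k ≤ n → FLe k n
almostSquare⇒FLe {k = suc k} as _ k<n = All.lookup as (∈-map⁺ suc (∈-upTo⁺ k<n))

almostSquare⇒balanced : ∀ {n} → 1 ≤ n → AlmostSquare n → Balanced n
almostSquare⇒balanced {n} 1≤n as = decidable-stable (balanced? n) λ ¬bal →
  let k , 1≤k , k≤n , ¬FLe = unbalanced-beaten 1≤n ¬bal in ¬FLe (almostSquare⇒FLe as 1≤k k≤n)

𝟙-almostSquare≡𝟙-balanced : ∀ n → 𝟙 (almostSquare? (suc n)) ≡ 𝟙 (balanced? (suc n))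
𝟙-almostSquare≡𝟙-balanced n =
  𝟙-cong (almostSquare⇒balanced (s≤s z≤n)) balanced⇒almostSquare (almostSquare? (suc n)) (balanced? (suc n))

-- T − h is even because T² − h² = 4n.
difference-of-squares : ∀ {n h T} → 4 * n + h * h ≡ T * T → ∃ λ d → n ≡ d * (d + h) × T ≡ d + (d + h)
difference-of-squares {n} {h} {T} eq
  with m≤n⇒∃[o]m+o≡n (m*m≤n*n⇒m≤n {h} {T} (≤-trans (m≤n+m (h * h) (4 * n)) (≤-reflexive eq)))
... | r , refl with half r
...   | d , inj₁ refl = d , *-cancelˡ-≡ n (d * (d + h)) 4 (+-cancelʳ-≡ (h * h) _ _ (begin
        4 * n + h * h                 ≡⟨ eq ⟩
        (h + 2 * d) * (h + 2 * d)     ≡⟨ solve (h ∷ d ∷ []) ⟩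
        4 * (d * (d + h)) + h * h     ∎)) , solve (h ∷ d ∷ [])
  where open ≡-Reasoning
...   | d , inj₂ refl = ⊥-elim (even≢odd (2 * n) (2 * (d * d) + 2 * d + 2 * (h * d) + h) (+-cancelʳ-≡ (h * h) _ _ (begin
        2 * (2 * n) + h * h                                   ≡⟨ solve (n ∷ h ∷ []) ⟩
        4 * n + h * h                                         ≡⟨ eq ⟩
        (h + suc (2 * d)) * (h + suc (2 * d))                 ≡⟨ solve (h ∷ d ∷ []) ⟩
        suc (2 * (2 * (d * d) + 2 * d + 2 * (h * d) + h)) + h * h ∎)))
  where open ≡-Reasoning

square-gap⇒balanced : ∀ {n h T} → 4 * n + h * h ≡ T * T → h * h ≤ T → Balanced n
square-gap⇒balanced {n} {h} {T} eq h²≤T with d , refl , refl ← difference-of-squares {n} {h} {T} eq =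
  factor-pair⇒balanced d (d + h) (begin
    (d + (d + h)) * (d + (d + h))     ≡⟨ eq ⟨
    4 * (d * (d + h)) + h * h         ≤⟨ +-monoʳ-≤ (4 * (d * (d + h))) h²≤T ⟩
    4 * (d * (d + h)) + (d + (d + h)) ∎)
  where open ≤-Reasoning

balanced⇒square-gap : ∀ {n} → Balanced n → ∃₂ λ h T → 4 * n + h * h ≡ T * T × h * h ≤ T
balanced⇒square-gap {n} bal with d , h , refl , sn≡ ← s-attained n =
  h , d + (d + h) , factor-pair-identity d h , +-cancelˡ-≤ (4 * (d * (d + h))) _ _ (begin
    4 * (d * (d + h)) + h * h         ≡⟨ factor-pair-identity d h ⟩
    (d + (d + h)) * (d + (d + h))     ≤⟨ subst (λ t → t * t ≤ 4 * (d * (d + h)) + t) sn≡ bal ⟩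
    4 * (d * (d + h)) + (d + (d + h)) ∎)
  where open ≤-Reasoning

-- Balanced numbers between consecutive squares

-- n = d (d + h) with 2d + h ∈ {2M + 1, 2M + 2} (see difference-of-squares) and h² ≤ 2M + 2
Gap : ℕ → ℕ → ℕ → Set
Gap M n h = h * h ≤ 2 * suc M ×
            (4 * n + h * h ≡ suc (2 * M) * suc (2 * M) ⊎ 4 * n + h * h ≡ 2 * suc M * (2 * suc M))

gap? : ∀ M n h → Dec (Gap M n h)
gap? M n h = h * h ≤? 2 * suc M ×-dec
             (4 * n + h * h ℕ.≟ suc (2 * M) * suc (2 * M) ⊎-dec 4 * n + h * h ℕ.≟ 2 * suc M * (2 * suc M))

[2M+2]²≡[2M+1]²+4M+3 : ∀ {M x y} → x ≡ suc (2 * M) * suc (2 * M) → y ≡ 2 * suc M * (2 * suc M) →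
                        y ≡ x + (4 * M + 3)
[2M+2]²≡[2M+1]²+4M+3 {M} refl refl = solve (M ∷ [])

gap⇒balanced : ∀ {M n h} → Gap M n h → Balanced n
gap⇒balanced {M} {n} {h} (h²≤2M+2 , inj₂ eq) = square-gap⇒balanced {n} {h} {2 * suc M} eq h²≤2M+2
gap⇒balanced {M} {n} {h} (h²≤2M+2 , inj₁ eq) = square-gap⇒balanced {n} {h} {suc (2 * M)} eq
  (≤-pred (≤-trans (≤∧≢⇒< h²≤2M+2 h²≢2M+2) (≤-reflexive (*-suc 2 M))))
  where
  h²≢2M+2 : h * h ≢ 2 * suc M
  h²≢2M+2 h²≡2M+2 = even≢odd (2 * n + suc M) (2 * (M * M) + 2 * M) (begin
    2 * (2 * n + suc M)               ≡⟨ solve (n ∷ M ∷ []) ⟩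
    4 * n + 2 * suc M                 ≡⟨ cong (4 * n ℕ.+_) h²≡2M+2 ⟨
    4 * n + h * h                     ≡⟨ eq ⟩
    suc (2 * M) * suc (2 * M)         ≡⟨ solve (M ∷ []) ⟩
    suc (2 * (2 * (M * M) + 2 * M))   ∎)
    where open ≡-Reasoning

balanced⇒gap : ∀ {M n} → M * M < n → n ≤ suc M * suc M → Balanced n → ∃ λ h → h < suc (2 * suc M) × Gap M n h
balanced⇒gap {M} {n} M²<n n≤[M+1]² bal with h , T , eq , h²≤T ← balanced⇒square-gap {n} bal =
  h , s≤s (≤-trans (n≤n*n h) h²≤2M+2) , h²≤2M+2 , Sum.map sum-is sum-is T≡2M+1⊎T≡2M+2
  where
  sum-is : ∀ {x} → T ≡ x → 4 * n + h * h ≡ x * x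
  sum-is refl = eq
  T²≤4n+T : T * T ≤ 4 * n + T
  T²≤4n+T = ≤-trans (≤-reflexive (sym eq)) (+-monoʳ-≤ (4 * n) h²≤T)
  2M<T : 2 * M < T
  2M<T = m*m<n*n⇒m<n {2 * M} {T} (begin-strict
    2 * M * (2 * M) ≡⟨ solve (M ∷ []) ⟩
    4 * (M * M)     <⟨ *-monoʳ-< 4 M²<n ⟩
    4 * n           ≤⟨ m≤m+n (4 * n) (h * h) ⟩
    4 * n + h * h   ≡⟨ eq ⟩
    T * T           ∎)
    where open ≤-Reasoning
  T≤2M+2 : T ≤ 2 * suc M
  T≤2M+2 = ≤-trans (≤-pred (m*m≤o+m∧o+n<n*n⇒m<n {T} {2 + suc (2 * M)} {4 * n} T²≤4n+T (begin-strict
    4 * n + (2 + suc (2 * M))               ≤⟨ +-monoˡ-≤ _ (*-monoʳ-≤ 4 n≤[M+1]²) ⟩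
    4 * (suc M * suc M) + (2 + suc (2 * M)) <⟨ m+o≡n⇒m≤n (2 * M + 1) (solve (M ∷ [])) ⟩
    (2 + suc (2 * M)) * (2 + suc (2 * M))   ∎))) (≤-reflexive (sym (*-suc 2 M)))
    where open ≤-Reasoning
  T≡2M+1⊎T≡2M+2 : T ≡ suc (2 * M) ⊎ T ≡ 2 * suc M
  T≡2M+1⊎T≡2M+2 = Sum.map₂ (λ T≡ → trans T≡ (sym (*-suc 2 M)))
    (m≤n<2+m⇒n≡m⊎n≡1+m 2M<T (s≤s (≤-trans T≤2M+2 (≤-reflexive (*-suc 2 M)))))
  h²≤2M+2 : h * h ≤ 2 * suc M
  h²≤2M+2 = ≤-trans h²≤T T≤2M+2

across-sums⇒2M+2<h′² : ∀ {M n h h′} → 4 * n + h * h ≡ suc (2 * M) * suc (2 * M) →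
                        4 * n + h′ * h′ ≡ 2 * suc M * (2 * suc M) → 2 * suc M < h′ * h′
across-sums⇒2M+2<h′² {M} {n} {h} {h′} eq eq′ = begin-strict
  2 * suc M         <⟨ m+o≡n⇒m≤n (2 * M) (solve (M ∷ [])) ⟩
  4 * M + 3         ≤⟨ m≤n+m (4 * M + 3) (h * h) ⟩
  h * h + (4 * M + 3) ≡⟨ h′²≡h²+4M+3 ⟨
  h′ * h′           ∎
  where
  open ≤-Reasoning
  h′²≡h²+4M+3 : h′ * h′ ≡ h * h + (4 * M + 3)
  h′²≡h²+4M+3 = +-cancelˡ-≡ (4 * n) _ _ (trans ([2M+2]²≡[2M+1]²+4M+3 {M} eq eq′) (+-assoc (4 * n) (h * h) _))

gap-unique-h : ∀ {M n h h′} → Gap M n h → Gap M n h′ → h ≡ h′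
gap-unique-h {n = n} {h} {h′} (_ , inj₁ eq) (_ , inj₁ eq′) =
  m*m≡n*n⇒m≡n {h} {h′} (+-cancelˡ-≡ (4 * n) _ _ (trans eq (sym eq′)))
gap-unique-h {n = n} {h} {h′} (_ , inj₂ eq) (_ , inj₂ eq′) =
  m*m≡n*n⇒m≡n {h} {h′} (+-cancelˡ-≡ (4 * n) _ _ (trans eq (sym eq′)))
gap-unique-h {M} {n} {h} {h′} (_ , inj₁ eq) (h′²≤2M+2 , inj₂ eq′) =
  ⊥-elim (<⇒≱ (across-sums⇒2M+2<h′² {M} {n} {h} {h′} eq eq′) h′²≤2M+2)
gap-unique-h {M} {n} {h} {h′} (h²≤2M+2 , inj₂ eq) (_ , inj₁ eq′) =
  ⊥-elim (<⇒≱ (across-sums⇒2M+2<h′² {M} {n} {h′} {h} eq′ eq) h²≤2M+2)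

across-sums-same-h⇒⊥ : ∀ {M n n′ h} → 4 * n + h * h ≡ suc (2 * M) * suc (2 * M) →
                     4 * n′ + h * h ≡ 2 * suc M * (2 * suc M) → ⊥
across-sums-same-h⇒⊥ {M} {n} {n′} {h} eq eq′ =
  even≢odd (2 * n′) (2 * n + 2 * M + 1) (+-cancelʳ-≡ (h * h) _ _ (begin
  2 * (2 * n′) + h * h                  ≡⟨ solve (n′ ∷ h ∷ []) ⟩
  4 * n′ + h * h                        ≡⟨ [2M+2]²≡[2M+1]²+4M+3 {M} eq eq′ ⟩
  4 * n + h * h + (4 * M + 3)           ≡⟨ solve (n ∷ h ∷ M ∷ []) ⟩
  suc (2 * (2 * n + 2 * M + 1)) + h * h ∎))
  where open ≡-Reasoning

gap-unique-n : ∀ {M n n′ h} → Gap M n h → Gap M n′ h → n ≡ n′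
gap-unique-n {n = n} {n′} {h} (_ , inj₁ eq) (_ , inj₁ eq′) =
  *-cancelˡ-≡ n n′ 4 (+-cancelʳ-≡ (h * h) _ _ (trans eq (sym eq′)))
gap-unique-n {n = n} {n′} {h} (_ , inj₂ eq) (_ , inj₂ eq′) =
  *-cancelˡ-≡ n n′ 4 (+-cancelʳ-≡ (h * h) _ _ (trans eq (sym eq′)))
gap-unique-n {M} {n} {n′} {h} (_ , inj₁ eq) (_ , inj₂ eq′) = ⊥-elim (across-sums-same-h⇒⊥ {M} {n} {n′} {h} eq eq′)
gap-unique-n {M} {n} {n′} {h} (_ , inj₂ eq) (_ , inj₁ eq′) = ⊥-elim (across-sums-same-h⇒⊥ {M} {n′} {n} {h} eq′ eq)

even-gap-exists : ∀ {M j} → 2 * j * (2 * j) ≤ 2 * suc M →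
                  ∃ λ n → M * M < n × n ≤ suc M * suc M × 4 * n + 2 * j * (2 * j) ≡ 2 * suc M * (2 * suc M)
even-gap-exists {M} {j} h²≤2M+2 =
  let n , e = m≤n⇒∃[o]m+o≡n (≤-trans (<⇒≤ j²<2M+1) (≤-trans (m≤m+n _ (M * M)) (≤-reflexive [M+1]²≡)))
  in n , from-complement e
  where
  j²<2M+1 : j * j < suc (2 * M)
  j²<2M+1 = *-cancelˡ-< 4 _ _ (begin-strict
    4 * (j * j)       ≡⟨ solve (j ∷ []) ⟩
    2 * j * (2 * j)   ≤⟨ h²≤2M+2 ⟩
    2 * suc M         <⟨ m+o≡n⇒m≤n (6 * M + 1) (solve (M ∷ [])) ⟩
    4 * suc (2 * M)   ∎)
    where open ≤-Reasoning
  [M+1]²≡ : suc (2 * M) + M * M ≡ suc M * suc M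
  [M+1]²≡ = solve (M ∷ [])
  from-complement : ∀ {n} → j * j + n ≡ suc M * suc M →
                    M * M < n × n ≤ suc M * suc M × 4 * n + 2 * j * (2 * j) ≡ 2 * suc M * (2 * suc M)
  from-complement {n} e =
    +-cancelˡ-< (j * j) (M * M) n (≤-trans (+-monoˡ-< (M * M) j²<2M+1) (≤-reflexive (trans [M+1]²≡ (sym e)))) ,
    ≤-trans (m≤n+m n (j * j)) (≤-reflexive e) ,
    (begin
      4 * n + 2 * j * (2 * j) ≡⟨ solve (n ∷ j ∷ []) ⟩
      4 * (j * j + n)         ≡⟨ cong (4 *_) e ⟩
      4 * (suc M * suc M)     ≡⟨ solve (M ∷ []) ⟩
      2 * suc M * (2 * suc M) ∎)
    where open ≡-Reasoning

odd-gap-exists : ∀ {M i} → 1 ≤ M → suc (2 * i) * suc (2 * i) ≤ 2 * suc M →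
                 ∃ λ n → M * M < n × n ≤ suc M * suc M × 4 * n + suc (2 * i) * suc (2 * i) ≡ suc (2 * M) * suc (2 * M)
odd-gap-exists {M@(suc M′)} {i} _ h²≤2M+2 =
  let n , e = m≤n⇒∃[o]m+o≡n (≤-trans (<⇒≤ x<M) (m≤m*n M (suc M))) in n , from-complement e
  where
  x : ℕ
  x = i * suc i
  x<M : i * suc i < M
  x<M = *-cancelˡ-< 4 _ _ (begin-strict
    4 * (i * suc i)           <⟨ n<1+n (4 * (i * suc i)) ⟩
    suc (4 * (i * suc i))     ≡⟨ solve (i ∷ []) ⟩
    suc (2 * i) * suc (2 * i) ≤⟨ h²≤2M+2 ⟩
    2 * suc M                 ≤⟨ m+o≡n⇒m≤n (2 * M′) (solve (M′ ∷ [])) ⟩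
    4 * M                     ∎)
    where open ≤-Reasoning
  from-complement : ∀ {n} → x + n ≡ M * suc M →
                    M * M < n × n ≤ suc M * suc M × 4 * n + suc (2 * i) * suc (2 * i) ≡ suc (2 * M) * suc (2 * M)
  from-complement {n} e = M²<n , ≤-trans (m≤n+m n x) (≤-trans (≤-reflexive e) (*-monoˡ-≤ (suc M) (n≤1+n M))) , eq
    where
    M²<n : M * M < n
    M²<n = +-cancelˡ-< x (M * M) n (begin-strict
      x + M * M <⟨ +-monoˡ-< (M * M) x<M ⟩
      M + M * M ≡⟨ solve (M′ ∷ []) ⟩
      M * suc M ≡⟨ e ⟨
      x + n     ∎)
      where open ≤-Reasoning
    eq : 4 * n + suc (2 * i) * suc (2 * i) ≡ suc (2 * M) * suc (2 * M)
    eq = begin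
      4 * n + suc (2 * i) * suc (2 * i) ≡⟨ solve (n ∷ i ∷ []) ⟩
      suc (4 * (i * suc i + n))         ≡⟨ cong (λ y → suc (4 * y)) e ⟩
      suc (4 * (M * suc M))             ≡⟨ solve (M′ ∷ []) ⟩
      suc (2 * M) * suc (2 * M)         ∎
      where open ≡-Reasoning

gap-exists : ∀ {M h} → 1 ≤ M → h * h ≤ 2 * suc M → ∃ λ n → M * M < n × n ≤ suc M * suc M × Gap M n h
gap-exists {M} {h} 1≤M h²≤2M+2 with half h
... | j , inj₁ refl = let n , M²<n , n≤[M+1]² , eq = even-gap-exists {M} {j} h²≤2M+2
                      in n , M²<n , n≤[M+1]² , h²≤2M+2 , inj₂ eq
... | i , inj₂ refl = let n , M²<n , n≤[M+1]² , eq = odd-gap-exists {M} {i} 1≤M h²≤2M+2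
                      in n , M²<n , n≤[M+1]² , h²≤2M+2 , inj₁ eq

[M+1]²≡M²+2M+1 : ∀ M → suc M * suc M ≡ suc (M * M + 2 * M)
[M+1]²≡M²+2M+1 M = solve (M ∷ [])

between-squares : ∀ M {n} → M * M < n → n ≤ suc M * suc M → ∃ λ k → k < suc (2 * M) × suc (M * M + k) ≡ n
between-squares M M²<n n≤[M+1]² with k , refl ← m≤n⇒∃[o]m+o≡n M²<n =
  k , s≤s (+-cancelˡ-≤ (M * M) k (2 * M) (≤-pred (≤-trans n≤[M+1]² (≤-reflexive ([M+1]²≡M²+2M+1 M))))) , refl

balanced-between-squares : ∀ {M p} → 1 ≤ M → FloorSqrt (2 * suc M) p →
                           ∑[ k < suc (2 * M) ] 𝟙 (balanced? (suc (M * M + k))) ≡ suc p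
balanced-between-squares {M} {p} 1≤M (p²≤2M+2 , 2M+2<[p+1]²) = begin
  ∑[ k < K ] 𝟙 (balanced? (n k))                ≡⟨ ∑-cong K (λ k k<K → sym (row k k<K)) ⟩
  ∑[ k < K ] ∑[ h < H ] 𝟙 (gap? M (n k) h)      ≡⟨ ∑-swap K H (λ k h → 𝟙 (gap? M (n k) h)) ⟩
  ∑[ h < H ] ∑[ k < K ] 𝟙 (gap? M (n k) h)      ≡⟨ ∑-cong H (λ h _ → column h) ⟩
  ∑[ h < H ] 𝟙 (h * h ≤? 2 * suc M)             ≡⟨ ∑𝟙-initial (λ h → h * h ≤? 2 * suc M) p<H below above ⟩
  suc p                                          ∎
  where
  open ≡-Reasoning
  K H : ℕ
  K = suc (2 * M)
  H = suc (2 * suc M)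
  n : ℕ → ℕ
  n k = suc (M * M + k)
  row : ∀ k → k < K → ∑[ h < H ] 𝟙 (gap? M (n k) h) ≡ 𝟙 (balanced? (n k))
  row k k<K = ∑𝟙-unique (gap? M (n k)) H (balanced? (n k)) (λ {h} → gap⇒balanced {M} {n k} {h})
                         (balanced⇒gap M²<n n≤[M+1]²) (λ {h} {h′} → gap-unique-h {M} {n k} {h} {h′})
    where
    M²<n : M * M < n k
    M²<n = s≤s (m≤m+n (M * M) k)
    n≤[M+1]² : n k ≤ suc M * suc M
    n≤[M+1]² = ≤-trans (s≤s (+-monoʳ-≤ (M * M) (≤-pred k<K))) (≤-reflexive (sym ([M+1]²≡M²+2M+1 M)))
  column : ∀ h → ∑[ k < K ] 𝟙 (gap? M (n k) h) ≡ 𝟙 (h * h ≤? 2 * suc M)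
  column h = ∑𝟙-unique (λ k → gap? M (n k) h) K (h * h ≤? 2 * suc M) proj₁ gap-at unique
    where
    gap-at : h * h ≤ 2 * suc M → ∃ λ k → k < K × Gap M (n k) h
    gap-at h²≤2M+2 with m , M²<m , m≤[M+1]² , gap ← gap-exists {M} {h} 1≤M h²≤2M+2
                   with k , k<K , refl ← between-squares M M²<m m≤[M+1]² = k , k<K , gap
    unique : ∀ {k k′} → Gap M (n k) h → Gap M (n k′) h → k ≡ k′
    unique {k} {k′} gap gap′ = +-cancelˡ-≡ (M * M) k k′ (suc-injective (gap-unique-n {M} {n k} {n k′} {h} gap gap′))
  p<H : suc p ≤ H
  p<H = s≤s (≤-trans (n≤n*n p) p²≤2M+2)
  below : ∀ h → h < suc p → h * h ≤ 2 * suc M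
  below h h<p+1 = ≤-trans (*-mono-≤ (≤-pred h<p+1) (≤-pred h<p+1)) p²≤2M+2
  above : ∀ h → suc p ≤ h → ¬ (h * h ≤ 2 * suc M)
  above h p<h h²≤2M+2 = <⇒≱ 2M+2<[p+1]² (≤-trans (*-mono-≤ p<h p<h) h²≤2M+2)

A-suc-square : ∀ {M p} → 1 ≤ M → FloorSqrt (2 * suc M) p → A (suc M * suc M) ≡ A (M * M) + suc p
A-suc-square {M} {p} 1≤M fs = begin
  A (suc M * suc M)
    ≡⟨ A≡∑ (suc M * suc M) ⟩
  ∑< (suc M * suc M) g
    ≡⟨ cong (λ x → ∑< x g) (trans ([M+1]²≡M²+2M+1 M) (sym (+-suc (M * M) (2 * M)))) ⟩
  ∑< (M * M + suc (2 * M)) g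
    ≡⟨ ∑-split (M * M) (suc (2 * M)) g ⟩
  ∑< (M * M) g + ∑[ k < suc (2 * M) ] g (M * M + k)
    ≡⟨ cong₂ _+_ (sym (A≡∑ (M * M))) (∑-cong (suc (2 * M)) λ k _ → 𝟙-almostSquare≡𝟙-balanced (M * M + k)) ⟩
  A (M * M) + ∑[ k < suc (2 * M) ] 𝟙 (balanced? (suc (M * M + k)))
    ≡⟨ cong (A (M * M) ℕ.+_) (balanced-between-squares 1≤M fs) ⟩
  A (M * M) + suc p ∎
  where
  open ≡-Reasoning
  g : ℕ → ℕ
  g i = 𝟙 (almostSquare? (suc i))

-- The closed form of A(M²)

half-of-floorSqrt : ∀ {n p q} → FloorSqrt n p → 2 * q * (2 * q) ≤ n → n < 2 * suc q * (2 * suc q) → Half p q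
half-of-floorSqrt {q = q} (p²≤n , n<[p+1]²) 2q²≤n n<[2q+2]² = m≤n<2+m⇒n≡m⊎n≡1+m
  (≤-pred (m*m<n*n⇒m<n (≤-<-trans 2q²≤n n<[p+1]²)))
  (≤-trans (m*m<n*n⇒m<n (≤-<-trans p²≤n n<[2q+2]²)) (≤-reflexive (*-suc 2 q)))

-- A(M²) = B(M²) for p = ⌊√(2M)⌋ and q = ⌊p/2⌋, times 12 and rearranged to avoid subtraction
ClosedForm : (M p q a : ℕ) → Set
ClosedForm M p q a = 12 * a + 2 * (p * p * p) + 3 * (p * p) + 12 ≡ 12 * M + 12 * (M * p) + 5 * p + 6 * q

closedForm-steady : ∀ {M p q a} → ClosedForm M p q a → ClosedForm (suc M) p q (a + suc p)
closedForm-steady {M} {p} {q} {a} cf = begin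
  12 * (a + suc p) + 2 * (p * p * p) + 3 * (p * p) + 12      ≡⟨ solve (a ∷ p ∷ []) ⟩
  (12 * a + 2 * (p * p * p) + 3 * (p * p) + 12) + 12 * suc p ≡⟨ cong (_+ 12 * suc p) cf ⟩
  (12 * M + 12 * (M * p) + 5 * p + 6 * q) + 12 * suc p       ≡⟨ solve (M ∷ p ∷ q ∷ []) ⟩
  12 * suc M + 12 * (suc M * p) + 5 * p + 6 * q              ∎
  where open ≡-Reasoning

closedForm-jump : ∀ {M p q a δ} → ClosedForm M p q a → suc p * suc p ≡ suc (2 * M) + δ →
                  ClosedForm (suc M) (suc p) (q + δ) (a + suc (suc p))
closedForm-jump {M} {p} {q} {a} {δ} cf [p+1]²≡ = begin
  12 * (a + suc (suc p)) + 2 * (suc p * suc p * suc p) + 3 * (suc p * suc p) + 12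
    ≡⟨ solve (a ∷ p ∷ []) ⟩
  (12 * a + 2 * (p * p * p) + 3 * (p * p) + 12) + (6 * (suc p * suc p) + 12 * p + 23)
    ≡⟨ cong₂ (λ x y → x + (6 * y + 12 * p + 23)) cf [p+1]²≡ ⟩
  (12 * M + 12 * (M * p) + 5 * p + 6 * q) + (6 * (suc (2 * M) + δ) + 12 * p + 23)
    ≡⟨ solve (M ∷ p ∷ q ∷ δ ∷ []) ⟩
  12 * suc M + 12 * (suc M * suc p) + 5 * suc p + 6 * (q + δ) ∎
  where open ≡-Reasoning

closedForm-step : ∀ {M p q p′ a} → FloorSqrt (2 * M) p → Half p q → FloorSqrt (2 * suc M) p′ →
                  ClosedForm M p q a → ∃ λ q′ → Half p′ q′ × ClosedForm (suc M) p′ q′ (a + suc p′)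
closedForm-step {M} {p} {q} {p′} {a} (p²≤2M , 2M<[p+1]²) half-p (p′²≤2M+2 , 2M+2<[p′+1]²) cf
  with m≤n<2+m⇒n≡m⊎n≡1+m p≤p′ p′<2+p
  where
  p≤p′ : p ≤ p′
  p≤p′ = ≤-pred (m*m<n*n⇒m<n (≤-<-trans p²≤2M (≤-<-trans (*-monoʳ-≤ 2 (n≤1+n M)) 2M+2<[p′+1]²)))
  p′<2+p : p′ < 2 + p
  p′<2+p = m*m<n*n⇒m<n (begin-strict
    p′ * p′                 ≤⟨ p′²≤2M+2 ⟩
    2 * suc M               ≡⟨ *-suc 2 M ⟩
    suc (suc (2 * M))       ≤⟨ s≤s 2M<[p+1]² ⟩
    suc (suc p * suc p)     <⟨ m+o≡n⇒m≤n (2 * p + 1) (solve (p ∷ [])) ⟩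
    (2 + p) * (2 + p)       ∎)
    where open ≤-Reasoning
... | inj₁ refl = q , half-p , closedForm-steady {M} {p} {q} {a} cf
... | inj₂ refl with half-p | m≤n<2+m⇒n≡m⊎n≡1+m 2M<[p+1]² (s≤s (≤-trans p′²≤2M+2 (≤-reflexive (*-suc 2 M))))
...   | inj₁ refl | inj₁ [p+1]²≡2M+1 =
        q , inj₂ refl , subst (λ q′ → ClosedForm (suc M) p′ q′ (a + suc p′)) (+-identityʳ q)
                          (closedForm-jump {M} {p} {q} {a} {0} cf (trans [p+1]²≡2M+1 (sym (+-identityʳ _))))
...   | inj₂ refl | inj₂ [p+1]²≡2M+2 =
        q + 1 , inj₁ (solve (q ∷ [])) , closedForm-jump {M} {p} {q} {a} {1} cf (trans [p+1]²≡2M+2 (+-comm 1 _))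
...   | inj₁ refl | inj₂ [p+1]²≡2M+2 = ⊥-elim (even≢odd (suc M) (2 * (q * suc q)) (begin
        2 * suc M                         ≡⟨ *-suc 2 M ⟩
        suc (suc (2 * M))                 ≡⟨ [p+1]²≡2M+2 ⟨
        suc (2 * q) * suc (2 * q)         ≡⟨ solve (q ∷ []) ⟩
        suc (2 * (2 * (q * suc q)))       ∎))
  where open ≡-Reasoning
...   | inj₂ refl | inj₁ [p+1]²≡2M+1 = ⊥-elim (even≢odd (2 * (suc q * suc q)) M (begin
        2 * (2 * (suc q * suc q))             ≡⟨ solve (q ∷ []) ⟩
        suc (suc (2 * q)) * suc (suc (2 * q)) ≡⟨ [p+1]²≡2M+1 ⟩
        suc (2 * M)                           ∎))
  where open ≡-Reasoning

closedForm : ∀ {M p q} → 1 ≤ M → FloorSqrt (2 * M) p → Half p q → ClosedForm M p q (A (M * M))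
closedForm {1} {p} {q} _ fs half-p
  with refl ← floorSqrt-unique {2} {p} {1} fs (FloorSqrt 2 1 ∋ (s≤s z≤n , s≤s (s≤s (s≤s z≤n))))
  with refl ← half-unique {1} {q} {0} half-p (Half 1 0 ∋ inj₂ refl) = refl
closedForm {suc M@(suc _)} {p′} {q′} _ fs′ half-p′ =
  let p , fs = floorSqrt (2 * M)
      q , half-p = half p
      q″ , half-p″ , cf = closedForm-step {M} {p} {q} {p′} {A (M * M)} fs half-p fs′
                                          (closedForm {M} {p} {q} (s≤s z≤n) fs half-p)
  in subst₂ (ClosedForm (suc M) p′) (half-unique {p′} {q″} {q′} half-p″ half-p′)
            (sym (A-suc-square {M} {p′} (s≤s z≤n) fs′)) cf

-- B(M²) in ℚ(√(2M))

-- Just enough of ℚ(√D) to write down B.  Instantiated at Qa and at pairs of solver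
-- polynomials, it lets the ring solver expand BAt symbolically.
record RootOps (X : Set) : Set where
  infixl 6 _⊞_ _⊟_
  infixl 7 _⊠_
  field
    _⊞_ _⊟_ _⊠_ : X → X → X
    const       : ℚ → X
    root        : X

B-formula : ∀ {X : Set} → RootOps X → X → X → X → X
B-formula {X} ops m p q = B₀ ⊞ B₁
  where
  open RootOps ops
  γ δ B₀ B₁ : X
  γ  = root ⊟ p
  δ  = root ⊠ const (+ 1 ℚ./ 2) ⊟ q
  B₀ = const (+ 2 ℚ./ 3) ⊠ m ⊠ root
       ⊞ const (+ 1 ℚ./ 2) ⊠ m
       ⊞ (const (+ 2 ℚ./ 3) ⊞ γ ⊠ (const 1ℚ ⊟ γ) ⊠ const (+ 1 ℚ./ 2)) ⊠ root
  B₁ = γ ⊠ γ ⊠ γ ⊠ const (+ 1 ℚ./ 6)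
       ⊟ γ ⊠ γ ⊠ const (+ 1 ℚ./ 4)
       ⊟ γ ⊠ const (+ 5 ℚ./ 12)
       ⊟ δ ⊠ const (+ 1 ℚ./ 2)
       ⊟ const 1ℚ

qaOps : ℚ → RootOps Qa
qaOps D = record
  { _⊞_ = _+'_ ; _⊟_ = _-'_ ; _⊠_ = _*'_ ; const = emb ; root = 0ℚ ⊕ 1ℚ ·a }
  where open QaOps D

Bℚ : (D m p q : ℚ) → Qa
Bℚ D m p q = B-formula (qaOps D) (emb m) (emb p) (emb q)

-- Variables 0, 1, 2, 3 stand for A, M, p, q; B is expanded with D = 2M.
Poly : Set
Poly = Polynomial 4

polyOps : Poly → RootOps (Poly × Poly)
polyOps D = record
  { _⊞_   = λ (r , t) (r′ , t′) → r :+ r′ , t :+ t′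
  ; _⊟_   = λ (r , t) (r′ , t′) → r :- r′ , t :- t′
  ; _⊠_   = λ (r , t) (r′ , t′) → r :* r′ :+ (t :* t′) :* D , r :* t′ :+ t :* r′
  ; const = λ c → con c , con 0ℚ
  ; root  = con 0ℚ , con 1ℚ
  }

B-poly : Poly × Poly
B-poly = B-formula (polyOps (con (ℕ→ℚ 2) :* var m)) (var m , con 0ℚ) (var p , con 0ℚ) (var q , con 0ℚ)
  where
  m p q : Fin 4
  m = # 1
  p = # 2
  q = # 3

im-Bℚ : ∀ m p q → im (Bℚ (ℕ→ℚ 2 ℚ.* m) m p q) ≡ 0ℚ
im-Bℚ m p q = prove (Vec.fromList (0ℚ ∷ m ∷ p ∷ q ∷ [])) (proj₂ B-poly) (con 0ℚ) refl

ℕ→ℚ≡mkℚ : ∀ n → ℕ→ℚ n ≡ ℚ.mkℚ (+ n) 0 (coprime-sym (1-coprimeTo n))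
ℕ→ℚ≡mkℚ n = ℚ.normalize-coprime _

ℕ→ℚ-+ : ∀ m n → ℕ→ℚ (m ℕ.+ n) ≡ ℕ→ℚ m ℚ.+ ℕ→ℚ n
ℕ→ℚ-+ m n rewrite ℕ→ℚ≡mkℚ m | ℕ→ℚ≡mkℚ n =
  cong (ℚ._/ 1) (trans (ℤ.pos-+ m n) (sym (cong₂ ℤ._+_ (ℤ.*-identityʳ (+ m)) (ℤ.*-identityʳ (+ n)))))

ℕ→ℚ-* : ∀ m n → ℕ→ℚ (m ℕ.* n) ≡ ℕ→ℚ m ℚ.* ℕ→ℚ n
ℕ→ℚ-* m n rewrite ℕ→ℚ≡mkℚ m | ℕ→ℚ≡mkℚ n = cong (ℚ._/ 1) (ℤ.pos-* m n)

-- The two sides of ClosedForm as syntax, to be read in ℕ and as solver polynomials over ℚ.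
infixl 6 _+ᴱ_
infixl 7 _*ᴱ_
data Expr : Set where
  num       : ℕ → Expr
  arg       : Fin 4 → Expr
  _+ᴱ_ _*ᴱ_ : Expr → Expr → Expr

⟦_⟧ℕ : Expr → Vec ℕ 4 → ℕ
⟦ num k ⟧ℕ ρ = k
⟦ arg i ⟧ℕ ρ = lookup ρ i
⟦ e +ᴱ f ⟧ℕ ρ = ⟦ e ⟧ℕ ρ ℕ.+ ⟦ f ⟧ℕ ρ
⟦ e *ᴱ f ⟧ℕ ρ = ⟦ e ⟧ℕ ρ ℕ.* ⟦ f ⟧ℕ ρ

toPoly : Expr → Poly
toPoly (num k) = con (ℕ→ℚ k)
toPoly (arg i) = var i
toPoly (e +ᴱ f) = toPoly e :+ toPoly f
toPoly (e *ᴱ f) = toPoly e :* toPoly f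

ℕ→ℚ-⟦⟧ : ∀ e ρ → ℕ→ℚ (⟦ e ⟧ℕ ρ) ≡ ⟦ toPoly e ⟧ (Vec.map ℕ→ℚ ρ)
ℕ→ℚ-⟦⟧ (num k) ρ = refl
ℕ→ℚ-⟦⟧ (arg i) ρ = sym (lookup-map i ℕ→ℚ ρ)
ℕ→ℚ-⟦⟧ (e +ᴱ f) ρ = trans (ℕ→ℚ-+ (⟦ e ⟧ℕ ρ) _) (cong₂ ℚ._+_ (ℕ→ℚ-⟦⟧ e ρ) (ℕ→ℚ-⟦⟧ f ρ))
ℕ→ℚ-⟦⟧ (e *ᴱ f) ρ = trans (ℕ→ℚ-* (⟦ e ⟧ℕ ρ) _) (cong₂ ℚ._*_ (ℕ→ℚ-⟦⟧ e ρ) (ℕ→ℚ-⟦⟧ f ρ))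

closedForm-lhs closedForm-rhs : Expr
closedForm-lhs = num 12 *ᴱ a +ᴱ num 2 *ᴱ (p *ᴱ p *ᴱ p) +ᴱ num 3 *ᴱ (p *ᴱ p) +ᴱ num 12
  where a p : Expr
        a = arg (# 0)
        p = arg (# 2)
closedForm-rhs = num 12 *ᴱ M +ᴱ num 12 *ᴱ (M *ᴱ p) +ᴱ num 5 *ᴱ p +ᴱ num 6 *ᴱ q
  where M p q : Expr
        M = arg (# 1)
        p = arg (# 2)
        q = arg (# 3)

RealEq-of-re-im : ∀ D {x} r → re x ≡ r → im x ≡ 0ℚ → QaOps.RealEq D x r
RealEq-of-re-im D r refl refl =
  trans (cong (λ z → z ℚ.* z) (ℚ.+-inverseʳ r)) (sym (ℚ.*-zeroˡ D)) ,
  ℚ.≤-reflexive (sym (ℚ.*-zeroˡ (r ℚ.- r)))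

closedForm⇒RealEq : ∀ {M p q a} → ClosedForm M p q a → QaOps.RealEq (ℕ→ℚ (2 ℕ.* M)) (BAt M p q) (ℕ→ℚ a)
closedForm⇒RealEq {M} {p} {q} {a} cf = RealEq-of-re-im (ℕ→ℚ (2 ℕ.* M)) (ℕ→ℚ a) re≡a im≡0
  where
  ρℕ : Vec ℕ 4
  ρℕ = Vec.fromList (a ∷ M ∷ p ∷ q ∷ [])
  ρ : Vec ℚ 4
  ρ = Vec.map ℕ→ℚ ρℕ
  D≡2M : ℕ→ℚ (2 ℕ.* M) ≡ ℕ→ℚ 2 ℚ.* ℕ→ℚ M
  D≡2M = ℕ→ℚ-* 2 M
  im≡0 : im (BAt M p q) ≡ 0ℚ
  im≡0 = trans (cong (λ D → im (Bℚ D (ℕ→ℚ M) (ℕ→ℚ p) (ℕ→ℚ q))) D≡2M)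
               (im-Bℚ (ℕ→ℚ M) (ℕ→ℚ p) (ℕ→ℚ q))
  lhs rhs lhs-12a : Poly
  lhs = toPoly closedForm-lhs
  rhs = toPoly closedForm-rhs
  lhs-12a = con (ℕ→ℚ 2) :* (p̂ :* p̂ :* p̂) :+ con (ℕ→ℚ 3) :* (p̂ :* p̂) :+ con (ℕ→ℚ 12)
    where p̂ : Poly
          p̂ = var (# 2)
  1/12 : ℚ
  1/12 = + 1 ℚ./ 12
  lhs≡rhs : ⟦ lhs ⟧ ρ ≡ ⟦ rhs ⟧ ρ
  lhs≡rhs = trans (sym (ℕ→ℚ-⟦⟧ closedForm-lhs ρℕ)) (trans (cong ℕ→ℚ cf) (ℕ→ℚ-⟦⟧ closedForm-rhs ρℕ))
  re≡a : re (BAt M p q) ≡ ℕ→ℚ a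
  re≡a = begin
    re (BAt M p q)                                     ≡⟨ cong (λ D → re (Bℚ D (ℕ→ℚ M) (ℕ→ℚ p) (ℕ→ℚ q))) D≡2M ⟩
    re (Bℚ (ℕ→ℚ 2 ℚ.* ℕ→ℚ M) (ℕ→ℚ M) (ℕ→ℚ p) (ℕ→ℚ q)) ≡⟨ prove ρ (proj₁ B-poly) (con 1/12 :* (rhs :- lhs-12a)) refl ⟩
    ⟦ con 1/12 :* (rhs :- lhs-12a) ⟧ ρ                 ≡⟨ cong (λ z → 1/12 ℚ.* (z ℚ.- ⟦ lhs-12a ⟧ ρ)) lhs≡rhs ⟨
    ⟦ con 1/12 :* (lhs :- lhs-12a) ⟧ ρ                 ≡⟨ prove ρ (con 1/12 :* (lhs :- lhs-12a)) (var (# 0)) refl ⟩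
    ℕ→ℚ a                                              ∎
    where open ≡-Reasoning

lemma7 : (M p q : ℕ) → 1 ≤ M
    → p * p ≤ 2 * M → 2 * M < suc p * suc p
    → (2 * q) * (2 * q) ≤ 2 * M → 2 * M < (2 * suc q) * (2 * suc q)
    → AEqB M p q
lemma7 M p q 1≤M p²≤2M 2M<[p+1]² 2q²≤2M 2M<[2q+2]² =
  closedForm⇒RealEq {M} {p} {q} {A (M * M)}
    (closedForm {M} {p} {q} 1≤M √2M≡p (half-of-floorSqrt {2 * M} {p} {q} √2M≡p 2q²≤2M 2M<[2q+2]²))
  where
  √2M≡p : FloorSqrt (2 * M) p
  √2M≡p = p²≤2M , 2M<[p+1]²
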